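{- For all nonnegative integers $h,k$, $$D_q(h,k)=\sum_{j=0}^{h}q^{(h-j)(k-j)}(-q;q)_j\left[{k\atop j}\right]_q\left[{h\atop j}\right]_q .$$
   Context: The $q$-integer is $[m]_q=(1-q^m)/(1-q)$ and the $q$-binomial coefficient is $\left[{h\atop k}\right]_q=\frac{[h]_q[h-1]_q\cdots[h-k+1]_q}{[k]_q[k-1]_q\cdots[1]_q}$, with $\left[{h\atop 0}\right]_q=1$ and $\left[{h\atop k}\right]_q=0$ for $k<0$. $(-q;q)_j=\prod_{i=1}^{j}(1+q^i)$. For nonnegative integers $h,k$ the $q$-Delannoy number is $D_q(h,k)=\sum_{j=0}^{h}q^{\binom{j+1}{2}}\left[{k\atop j}\right]_q\left[{h+k-j\atop k}\right]_q$. -}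

module Defs where

open import Level using (Level)
open import Algebra.Bundles using (CommutativeRing)
open import Data.Nat using (ℕ; zero; suc; _∸_) renaming (_*_ to _*ℕ_; _+_ to _+ℕ_)
open import Data.Nat.Combinatorics using (_C_)

module QDefs {c ℓ : Level} (R : CommutativeRing c ℓ) where
  open CommutativeRing R

  pow : Carrier → ℕ → Carrier
  pow q zero    = 1#
  pow q (suc n) = q * pow q n

  sumTo : ℕ → (ℕ → Carrier) → Carrier
  sumTo zero    f = f 0
  sumTo (suc n) f = sumTo n f + f (suc n)

  -- q-integer [m]_q = (1 - q^m)/(1 - q) = 1 + q + ... + q^(m-1)
  qInt : Carrier → ℕ → Carrier
  qInt q zero    = 0#
  qInt q (suc m) = 1# + q * qInt q m

  -- Gaussian (q-binomial) coefficient [h choose k]_q as a polynomial in q,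
  -- via the q-Pascal rule [h+1, k+1] = [h, k] + q^(k+1) [h, k+1];
  -- [h, 0] = 1, [0, k+1] = 0 (and [h, k] = 0 for k > h).
  qBinom : Carrier → ℕ → ℕ → Carrier
  qBinom q h       zero    = 1#
  qBinom q zero    (suc k) = 0#
  qBinom q (suc h) (suc k) = qBinom q h k + pow q (suc k) * qBinom q h (suc k)

  -- (-q; q)_j = Π_{i=1}^{j} (1 + q^i)
  negQPoch : Carrier → ℕ → Carrier
  negQPoch q zero    = 1#
  negQPoch q (suc j) = negQPoch q j * (1# + pow q (suc j))

  qDelannoy : Carrier → ℕ → ℕ → Carrier
  qDelannoy q h k =
    sumTo h (λ j → pow q ((suc j) C 2) * qBinom q k j * qBinom q ((h +ℕ k) ∸ j) k)

module Submission where

-- Both sides satisfy the q-Delannoy recurrence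
--   F(h+1,k+1) = F(h+1,k) + q^{k+1} (F(h,k+1) + F(h,k)),   F(0,k) = F(h,0) = 1,
-- so they agree by double induction ("unique").  Everything rests on the two
-- q-Pascal rules, written uniformly in j with the convention [n,-1] = 0:
--   [n+1,j] = [n,j-1] + q^j [n,j]   and   [n+1,j] = [n,j] + q^{n+1-j} [n,j-1].
-- For D_q, the first rule on [h+k+2-j,k+1] and the second on [k+1,j] split the
-- sum into the three sums of the recurrence.  For the right-hand side, the first
-- rule on [h+1,j] and the second on [k+1,j] and on [h+1,j] give the recurrence
-- up to one sum reappearing shifted by one index, where
-- (-q;q)_{j+1} = (-q;q)_j (1 + q^{j+1}) supplies the missing term q^{k+1} F(h,k).
-- Truncated subtraction in exponents is harmless: each such exponent multiplies
-- a Gaussian coefficient vanishing wherever the subtraction is not exact.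

open import Defs
open import Level using (Level)
open import Algebra.Bundles using (CommutativeRing)
open import Data.Nat using (ℕ; zero; suc; _∸_; _≤_; _<_; z≤n; s≤s; _≤?_)
  renaming (_*_ to _*ℕ_; _+_ to _+ℕ_)
open import Data.Nat.Properties
  using ( +-∸-assoc; m∸n+n≡m; m+n∸m≡n; +-suc; *-suc; *-zeroʳ; ≰⇒>; n<1+n; m<n⇒m<1+n
        ; m≤n⇒m≤1+n; ≤-refl; ≤-trans; ≤-reflexive; m≤m+n)
open import Data.Nat.Combinatorics using (_C_; nCk+nC[k+1]≡[n+1]C[k+1]; nC1≡n)
import Relation.Binary.PropositionalEquality as ≡
open import Relation.Binary.PropositionalEquality using (_≡_)
open import Relation.Nullary using (yes; no)

module RingSums {c ℓ : Level} (R : CommutativeRing c ℓ) where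
  open CommutativeRing R
  open QDefs R
  open import Algebra.Properties.CommutativeSemigroup +-commutativeSemigroup using (interchange)
  open import Algebra.Properties.CommutativeSemigroup *-commutativeSemigroup using (x∙yz≈y∙xz)

  pow-cong : ∀ x {m n} → m ≡ n → pow x m ≈ pow x n
  pow-cong x e = reflexive (≡.cong (pow x) e)

  pow-+ : ∀ x m n → pow x (m +ℕ n) ≈ pow x m * pow x n
  pow-+ x zero    n = sym (*-identityˡ _)
  pow-+ x (suc m) n = trans (*-congˡ (pow-+ x m n)) (sym (*-assoc _ _ _))

  pow-∸ : ∀ x {j n} → j ≤ n → pow x (n ∸ j) * pow x j ≈ pow x n
  pow-∸ x {j} {n} j≤n = trans (sym (pow-+ x (n ∸ j) j)) (pow-cong x (m∸n+n≡m j≤n))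

  sum-cong : ∀ n {f g : ℕ → Carrier} → (∀ j → j ≤ n → f j ≈ g j) → sumTo n f ≈ sumTo n g
  sum-cong zero    f≈g = f≈g 0 z≤n
  sum-cong (suc n) f≈g =
    +-cong (sum-cong n (λ j j≤n → f≈g j (m≤n⇒m≤1+n j≤n))) (f≈g (suc n) ≤-refl)

  sum-split : ∀ n {f g h : ℕ → Carrier} → (∀ j → j ≤ n → f j ≈ g j + h j) →
              sumTo n f ≈ sumTo n g + sumTo n h
  sum-split zero    split = split 0 z≤n
  sum-split (suc n) split =
    trans (+-cong (sum-split n (λ j j≤n → split j (m≤n⇒m≤1+n j≤n))) (split (suc n) ≤-refl))
          (interchange _ _ _ _)

  sum-scale : ∀ n x (f : ℕ → Carrier) → sumTo n (λ j → x * f j) ≈ x * sumTo n f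
  sum-scale zero    x f = refl
  sum-scale (suc n) x f = trans (+-congʳ (sum-scale n x f)) (sym (distribˡ x _ _))

  sum-shift : ∀ n (f : ℕ → Carrier) → sumTo (suc n) f ≈ f 0 + sumTo n (λ j → f (suc j))
  sum-shift zero    f = refl
  sum-shift (suc n) f = trans (+-congʳ (sum-shift n f)) (+-assoc _ _ _)

  sum-dropLast : ∀ n (f : ℕ → Carrier) → f (suc n) ≈ 0# → sumTo (suc n) f ≈ sumTo n f
  sum-dropLast n f last≈0 = trans (+-congˡ last≈0) (+-identityʳ _)

  sum-head : ∀ n (f : ℕ → Carrier) → (∀ j → f (suc j) ≈ 0#) → sumTo n f ≈ f 0
  sum-head zero    f tail≈0 = refl
  sum-head (suc n) f tail≈0 = trans (sum-dropLast n f (tail≈0 n)) (sum-head n f tail≈0)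

  wsum : (ℕ → Carrier) → ℕ → (ℕ → Carrier) → Carrier
  wsum w n f = sumTo n (λ j → w j * f j)

  wsum-split : ∀ w n {f g h : ℕ → Carrier} → (∀ j → j ≤ n → f j ≈ g j + h j) →
               wsum w n f ≈ wsum w n g + wsum w n h
  wsum-split w n split = sum-split n (λ j j≤n → trans (*-congˡ (split j j≤n)) (distribˡ _ _ _))

  wsum-dropLast : ∀ w n (f : ℕ → Carrier) → f (suc n) ≈ 0# → wsum w (suc n) f ≈ wsum w n f
  wsum-dropLast w n f last≈0 = sum-dropLast n _ (trans (*-congˡ last≈0) (zeroʳ (w (suc n))))

  wsum-scale : ∀ w n x (f : ℕ → Carrier) → wsum w n (λ j → x * f j) ≈ x * wsum w n f
  wsum-scale w n x f =
    trans (sum-cong n (λ j _ → x∙yz≈y∙xz (w j) x (f j))) (sum-scale n x (λ j → w j * f j))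

module QDelannoyIdentity {c ℓ : Level} (R : CommutativeRing c ℓ) (q : CommutativeRing.Carrier R) where
  open CommutativeRing R
  open QDefs R
  open RingSums R
  open import Algebra.Solver.Ring.NaturalCoefficients.Default commutativeSemiring
    using (solve; _:=_; _:+_; _:*_; con)
  open import Relation.Binary.Reasoning.Setoid setoid

  infix 9 q^_
  q^_ : ℕ → Carrier
  q^_ = pow q

  B : ℕ → ℕ → Carrier
  B = qBinom q

  B₋ : ℕ → ℕ → Carrier
  B₋ n zero    = 0#
  B₋ n (suc j) = B n j

  P : ℕ → Carrier
  P = negQPoch q

  B-vanish : ∀ {n j} → n < j → B n j ≈ 0#
  B-vanish {zero}  {suc j} _         = refl
  B-vanish {suc n} {suc j} (s≤s n<j) =
    trans (+-cong (B-vanish n<j) (*-congˡ (B-vanish (m<n⇒m<1+n n<j))))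
          (trans (+-identityˡ _) (zeroʳ _))

  B-diag : ∀ n → B n n ≈ 1#
  B-diag zero    = refl
  B-diag (suc n) =
    trans (+-cong (B-diag n) (*-congˡ (B-vanish (n<1+n n))))
          (trans (+-congˡ (zeroʳ _)) (+-identityʳ _))

  -- Identities multiplied by [n,j] need only hold for j ≤ n; this is how
  -- truncated subtraction in exponents is tamed.
  onSupport : ∀ n j {x y} → (j ≤ n → x ≈ y) → x * B n j ≈ y * B n j
  onSupport n j {x} {y} x≈y with j ≤? n
  ... | yes j≤n = *-congʳ (x≈y j≤n)
  ... | no  j≰n = trans (*-congˡ vanish) (trans (zeroʳ x) (sym (trans (*-congˡ vanish) (zeroʳ y))))
    where vanish = B-vanish (≰⇒> j≰n)

  pascal₁ : ∀ n j → B (suc n) j ≈ B₋ n j + q^ j * B n j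
  pascal₁ n zero    = sym (trans (+-identityˡ _) (*-identityʳ _))
  pascal₁ n (suc j) = refl

  -- By induction on n, via the absorption identity
  --   [n+1,j] + q^{n+1} [n,j] = [n,j] + q^{n+1-j} [n+1,j],
  -- which is the first rule set against the second one at n.
  pascal₂ : ∀ n j → B (suc n) j ≈ B n j + q^ (suc n ∸ j) * B₋ n j
  pascal₂ n       zero          = sym (trans (+-congˡ (zeroʳ _)) (+-identityʳ _))
  pascal₂ zero    (suc zero)    =
    trans (+-cong refl (zeroʳ _)) (trans (+-identityʳ _) (sym (trans (+-identityˡ _) (*-identityˡ _))))
  pascal₂ zero    (suc (suc j)) =
    trans (trans (+-identityˡ _) (zeroʳ _)) (sym (trans (+-identityˡ _) (zeroʳ _)))
  pascal₂ (suc n) (suc j)       = begin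
    B (suc n) j + q^ (suc j) * B (suc n) (suc j)
      ≈⟨ +-congˡ (*-congˡ (pascal₂ n (suc j))) ⟩
    X + q^ (suc j) * (Y + q^ (n ∸ j) * Z)
      ≈⟨ solve 5 (λ X Y Z a b → X :+ a :* (Y :+ b :* Z) := a :* Y :+ (X :+ (a :* b) :* Z))
               refl X Y Z (q^ (suc j)) (q^ (n ∸ j)) ⟩
    q^ (suc j) * Y + (X + (q^ (suc j) * q^ (n ∸ j)) * Z)
      ≈⟨ +-congˡ (+-congˡ (onSupport n j (λ j≤n →
           trans (*-assoc q _ _) (*-congˡ (trans (*-comm _ _) (pow-∸ q j≤n)))))) ⟩
    q^ (suc j) * Y + (X + q^ (suc n) * Z)
      ≈⟨ +-congˡ absorb ⟩
    q^ (suc j) * Y + (Z + q^ (suc n ∸ j) * X)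
      ≈⟨ solve 5 (λ Y Z X a a' → a :* Y :+ (Z :+ a' :* X) := (Z :+ a :* Y) :+ a' :* X)
               refl Y Z X (q^ (suc j)) a' ⟩
    (Z + q^ (suc j) * Y) + q^ (suc n ∸ j) * X ∎
    where
    X = B (suc n) j
    Y = B n (suc j)
    Z = B n j
    a' = q^ (suc n ∸ j)
    absorb : X + q^ (suc n) * Z ≈ Z + q^ (suc n ∸ j) * X
    absorb = begin
      X + q^ (suc n) * Z
        ≈⟨ +-cong (pascal₂ n j) (onSupport n j (λ j≤n → sym (pow-∸ q (m≤n⇒m≤1+n j≤n)))) ⟩
      (Z + a' * B₋ n j) + (a' * q^ j) * Z
        ≈⟨ solve 4 (λ Z W a b → (Z :+ a :* W) :+ (a :* b) :* Z := Z :+ a :* (W :+ b :* Z))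
                 refl Z (B₋ n j) a' (q^ j) ⟩
      Z + a' * (B₋ n j + q^ j * Z)
        ≈⟨ +-congˡ (*-congˡ (sym (pascal₁ n j))) ⟩
      Z + a' * X ∎

  Q : ℕ → Carrier
  Q j = q^ (suc j C 2)

  Q-suc : ∀ j → Q (suc j) ≈ q^ (suc j) * Q j
  Q-suc j = trans (pow-cong q binom-step) (pow-+ q (suc j) (suc j C 2))
    where
    binom-step : suc (suc j) C 2 ≡ suc j +ℕ (suc j C 2)
    binom-step = ≡.trans (≡.sym (nCk+nC[k+1]≡[n+1]C[k+1] (suc j) 1))
                         (≡.cong (_+ℕ (suc j C 2)) (nC1≡n (suc j)))

  D : ℕ → ℕ → Carrier
  D = qDelannoy q

  δ : ℕ → ℕ → ℕ → Carrier
  δ h k j = Q j * B k j * B ((h +ℕ k) ∸ j) k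

  module DRecurrence (h k : ℕ) where

    -- The summand of D(h+1,k+1) after the first Pascal rule on [h+k+2-j,k+1].
    γ : ℕ → Carrier
    γ j = Q j * B (suc k) j * B ((suc h +ℕ k) ∸ j) k

    -- The part of γ produced by the second Pascal rule on [k+1,j].
    ε : ℕ → Carrier
    ε j = Q j * (q^ (suc k ∸ j) * B₋ k j) * B ((suc h +ℕ k) ∸ j) k

    -- First Pascal rule on [h+k+2-j,k+1]; j ≤ h+1 makes h+k+2-j a successor.
    δ-split : ∀ j → j ≤ suc h → δ (suc h) (suc k) j ≈ γ j + q^ (suc k) * δ h (suc k) j
    δ-split j j≤1+h = begin
      Q j * K * B ((suc h +ℕ suc k) ∸ j) (suc k)
        ≈⟨ *-congˡ (reflexive (≡.cong (λ m → B m (suc k)) (+-∸-assoc 1 j≤h+1+k))) ⟩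
      Q j * K * (B N k + q^ (suc k) * B N (suc k))
        ≈⟨ solve 5 (λ a b x c y → a :* b :* (x :+ c :* y) := a :* b :* x :+ c :* (a :* b :* y))
                 refl (Q j) K (B N k) (q^ (suc k)) (B N (suc k)) ⟩
      Q j * K * B N k + q^ (suc k) * δ h (suc k) j
        ≈⟨ +-congʳ (*-congˡ (reflexive (≡.cong (λ m → B (m ∸ j) k) (+-suc h k)))) ⟩
      γ j + q^ (suc k) * δ h (suc k) j ∎
      where
      K = B (suc k) j
      N = (h +ℕ suc k) ∸ j
      j≤h+1+k : j ≤ h +ℕ suc k
      j≤h+1+k = ≤-trans j≤1+h (≤-trans (s≤s (m≤m+n h k)) (≤-reflexive (≡.sym (+-suc h k))))

    γ-split : ∀ j → γ j ≈ δ (suc h) k j + ε j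
    γ-split j = begin
      Q j * B (suc k) j * X
        ≈⟨ *-congʳ (*-congˡ (pascal₂ k j)) ⟩
      Q j * (B k j + q^ (suc k ∸ j) * B₋ k j) * X
        ≈⟨ solve 4 (λ a b c x → a :* (b :+ c) :* x := a :* b :* x :+ a :* c :* x)
                 refl (Q j) (B k j) (q^ (suc k ∸ j) * B₋ k j) X ⟩
      δ (suc h) k j + ε j ∎
      where X = B ((suc h +ℕ k) ∸ j) k

    ε-zero : ε 0 ≈ 0#
    ε-zero = trans (*-congʳ (trans (*-congˡ (zeroʳ _)) (zeroʳ _))) (zeroˡ _)

    ε-suc : ∀ s → ε (suc s) ≈ q^ (suc k) * δ h k s
    ε-suc s = begin
      Q (suc s) * (q^ (k ∸ s) * B k s) * Y
        ≈⟨ *-congʳ (*-congʳ (Q-suc s)) ⟩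
      q * q^ s * Q s * (q^ (k ∸ s) * B k s) * Y
        ≈⟨ solve 6 (λ q a b c d y → q :* a :* b :* (c :* d) :* y := (q :* (c :* a) :* b) :* d :* y)
                 refl q (q^ s) (Q s) (q^ (k ∸ s)) (B k s) Y ⟩
      (q * (q^ (k ∸ s) * q^ s) * Q s) * B k s * Y
        ≈⟨ *-congʳ (onSupport k s (λ s≤k → *-congʳ (*-congˡ (pow-∸ q s≤k)))) ⟩
      (q^ (suc k) * Q s) * B k s * Y
        ≈⟨ solve 4 (λ a b c y → a :* b :* c :* y := a :* (b :* c :* y)) refl (q^ (suc k)) (Q s) (B k s) Y ⟩
      q^ (suc k) * δ h k s ∎
      where Y = B ((h +ℕ k) ∸ s) k

    ε-sum : sumTo (suc h) ε ≈ q^ (suc k) * D h k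
    ε-sum = begin
      sumTo (suc h) ε                                     ≈⟨ sum-shift h ε ⟩
      ε 0 + sumTo h (λ s → ε (suc s))                     ≈⟨ +-cong ε-zero (sum-cong h (λ s _ → ε-suc s)) ⟩
      0# + sumTo h (λ s → q^ (suc k) * δ h k s)           ≈⟨ trans (+-identityˡ _) (sum-scale h (q^ (suc k)) (δ h k)) ⟩
      q^ (suc k) * D h k                                  ∎

    -- The last summand of D(h,k+1) taken over j ≤ h+1 is [k,k+1] = 0.
    δ-last : δ h (suc k) (suc h) ≈ 0#
    δ-last = trans (*-congˡ (trans (reflexive (≡.cong (λ m → B m (suc k)) top)) (B-vanish (n<1+n k))))
                   (zeroʳ _)
      where
      top : (h +ℕ suc k) ∸ suc h ≡ k
      top = ≡.trans (≡.cong (_∸ suc h) (+-suc h k)) (m+n∸m≡n h k)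

    recurrence : D (suc h) (suc k) ≈ D (suc h) k + q^ (suc k) * (D h (suc k) + D h k)
    recurrence = begin
      D (suc h) (suc k)
        ≈⟨ sum-split (suc h) δ-split ⟩
      sumTo (suc h) γ + sumTo (suc h) (λ j → q^ (suc k) * δ h (suc k) j)
        ≈⟨ +-cong (sum-split (suc h) (λ j _ → γ-split j))
                  (trans (sum-scale (suc h) _ _) (*-congˡ (sum-dropLast h _ δ-last))) ⟩
      (D (suc h) k + sumTo (suc h) ε) + q^ (suc k) * D h (suc k)
        ≈⟨ +-congʳ (+-congˡ ε-sum) ⟩
      (D (suc h) k + q^ (suc k) * D h k) + q^ (suc k) * D h (suc k)
        ≈⟨ solve 4 (λ a c x y → (a :+ c :* y) :+ c :* x := a :+ c :* (x :+ y))
                 refl (D (suc h) k) (q^ (suc k)) (D h (suc k)) (D h k) ⟩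
      D (suc h) k + q^ (suc k) * (D h (suc k) + D h k) ∎

  onSupport₂ : ∀ m n j {x y} → (j ≤ m → j ≤ n → x ≈ y) → x * B m j * B n j ≈ y * B m j * B n j
  onSupport₂ m n j x≈y = onSupport n j (λ j≤n → onSupport m j (λ j≤m → x≈y j≤m j≤n))

  pow-sucˡ : ∀ {h j} b → j ≤ h → q^ ((suc h ∸ j) *ℕ b) ≈ q^ b * q^ ((h ∸ j) *ℕ b)
  pow-sucˡ {h} {j} b j≤h =
    trans (pow-cong q (≡.cong (_*ℕ b) (+-∸-assoc 1 j≤h))) (pow-+ q b ((h ∸ j) *ℕ b))

  pow-sucʳ : ∀ {h j} a → j ≤ h → q^ (a *ℕ (suc h ∸ j)) ≈ q^ a * q^ (a *ℕ (h ∸ j))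
  pow-sucʳ {h} {j} a j≤h =
    trans (pow-cong q (≡.trans (≡.cong (a *ℕ_) (+-∸-assoc 1 j≤h)) (*-suc a (h ∸ j))))
          (pow-+ q a (a *ℕ (h ∸ j)))

  pow-shift : ∀ {h m j} → j ≤ h → j ≤ m →
              q^ ((suc h ∸ j) *ℕ (m ∸ j)) * q^ j ≈ q^ m * q^ ((h ∸ j) *ℕ (m ∸ j))
  pow-shift {h} {m} {j} j≤h j≤m = begin
    q^ ((suc h ∸ j) *ℕ (m ∸ j)) * q^ j   ≈⟨ *-congʳ (pow-sucˡ (m ∸ j) j≤h) ⟩
    q^ (m ∸ j) * F * q^ j                ≈⟨ solve 3 (λ a f b → a :* f :* b := (a :* b) :* f) refl _ F _ ⟩
    (q^ (m ∸ j) * q^ j) * F              ≈⟨ *-congʳ (pow-∸ q j≤m) ⟩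
    q^ m * F                             ∎
    where F = q^ ((h ∸ j) *ℕ (m ∸ j))

  ρ : ℕ → ℕ → ℕ → Carrier
  ρ h k j = q^ ((h ∸ j) *ℕ (k ∸ j)) * B k j * B h j

  Rhs : ℕ → ℕ → Carrier
  Rhs h k = wsum P h (ρ h k)

  module RhsRecurrence (h k : ℕ) where

    -- The remainder of the first Pascal rule, the two pieces it and ρ(h+1,k,j)
    -- split into under the second rule, and ν shifted by one index.
    τ : ℕ → Carrier
    τ j = q^ ((suc h ∸ j) *ℕ (suc k ∸ j)) * B (suc k) j * B₋ h j

    μ : ℕ → Carrier
    μ j = q^ ((suc h ∸ j) *ℕ (suc k ∸ j)) * B k j * B₋ h j

    ν : ℕ → Carrier
    ν j = q^ ((suc h ∸ j) *ℕ (k ∸ j)) * B k j * B h j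

    ν₋ : ℕ → Carrier
    ν₋ zero    = 0#
    ν₋ (suc j) = ν j

    ρ-split : ∀ j → ρ (suc h) (suc k) j ≈ q^ (suc k) * ρ h (suc k) j + τ j
    ρ-split j = begin
      E * K * B (suc h) j
        ≈⟨ *-congˡ (pascal₁ h j) ⟩
      E * K * (B₋ h j + q^ j * B h j)
        ≈⟨ solve 5 (λ e k b p c → e :* k :* (b :+ p :* c) := (e :* p) :* k :* c :+ e :* k :* b)
                 refl E K (B₋ h j) (q^ j) (B h j) ⟩
      (E * q^ j) * K * B h j + E * K * B₋ h j
        ≈⟨ +-congʳ (onSupport₂ (suc k) h j (λ j≤1+k j≤h → pow-shift j≤h j≤1+k)) ⟩
      (q^ (suc k) * F) * K * B h j + E * K * B₋ h j
        ≈⟨ +-congʳ (solve 4 (λ a f k b → a :* f :* k :* b := a :* (f :* k :* b)) refl _ F K _) ⟩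
      q^ (suc k) * ρ h (suc k) j + E * K * B₋ h j ∎
      where
      E = q^ ((suc h ∸ j) *ℕ (suc k ∸ j))
      F = q^ ((h ∸ j) *ℕ (suc k ∸ j))
      K = B (suc k) j

    τ-split : ∀ j → τ j ≈ μ j + ν₋ j
    τ-split j = begin
      E * B (suc k) j * B₋ h j
        ≈⟨ *-congʳ (*-congˡ (pascal₂ k j)) ⟩
      E * (B k j + q^ (suc k ∸ j) * B₋ k j) * B₋ h j
        ≈⟨ solve 4 (λ e b c d → e :* (b :+ c) :* d := e :* b :* d :+ e :* c :* d)
                 refl E (B k j) (q^ (suc k ∸ j) * B₋ k j) (B₋ h j) ⟩
      μ j + E * (q^ (suc k ∸ j) * B₋ k j) * B₋ h j
        ≈⟨ +-congˡ (tail j) ⟩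
      μ j + ν₋ j ∎
      where
      E = q^ ((suc h ∸ j) *ℕ (suc k ∸ j))
      tail : ∀ j → q^ ((suc h ∸ j) *ℕ (suc k ∸ j)) * (q^ (suc k ∸ j) * B₋ k j) * B₋ h j ≈ ν₋ j
      tail zero    = zeroʳ _
      tail (suc s) = onSupport h s (λ s≤h → begin
        q^ ((h ∸ s) *ℕ (k ∸ s)) * (q^ (k ∸ s) * B k s)
          ≈⟨ solve 3 (λ f a b → f :* (a :* b) := (a :* f) :* b) refl _ _ _ ⟩
        (q^ (k ∸ s) * q^ ((h ∸ s) *ℕ (k ∸ s))) * B k s
          ≈⟨ *-congʳ (sym (pow-sucˡ (k ∸ s) s≤h)) ⟩
        q^ ((suc h ∸ s) *ℕ (k ∸ s)) * B k s ∎)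

    ρ-split' : ∀ j → ρ (suc h) k j ≈ ν j + μ j
    ρ-split' j = begin
      G * B k j * B (suc h) j
        ≈⟨ *-congˡ (pascal₂ h j) ⟩
      G * B k j * (B h j + q^ (suc h ∸ j) * B₋ h j)
        ≈⟨ solve 5 (λ g b c p d → g :* b :* (c :+ p :* d) := g :* b :* c :+ (g :* p) :* b :* d)
                 refl G (B k j) (B h j) (q^ (suc h ∸ j)) (B₋ h j) ⟩
      ν j + (G * q^ (suc h ∸ j)) * B k j * B₋ h j
        ≈⟨ +-congˡ (*-congʳ (onSupport k j (λ j≤k →
             trans (*-comm _ _) (sym (pow-sucʳ (suc h ∸ j) j≤k))))) ⟩
      ν j + μ j ∎
      where G = q^ ((suc h ∸ j) *ℕ (k ∸ j))

    weight-step : ∀ s → P (suc s) * ν s ≈ P s * ν s + q^ (suc k) * (P s * ρ h k s)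
    weight-step s = begin
      P s * (1# + q^ (suc s)) * (G * B k s * B h s)
        ≈⟨ solve 6 (λ p q a g b c → p :* (con 1 :+ q :* a) :* (g :* b :* c)
                       := p :* (g :* b :* c) :+ p :* ((q :* (g :* a)) :* b :* c))
                 refl (P s) q (q^ s) G (B k s) (B h s) ⟩
      P s * ν s + P s * ((q * (G * q^ s)) * B k s * B h s)
        ≈⟨ +-congˡ (*-congˡ (onSupport₂ k h s (λ s≤k s≤h → *-congˡ (pow-shift s≤h s≤k)))) ⟩
      P s * ν s + P s * ((q * (q^ k * F)) * B k s * B h s)
        ≈⟨ +-congˡ (solve 6 (λ p q a f b c → p :* ((q :* (a :* f)) :* b :* c) := (q :* a) :* (p :* (f :* b :* c)))
                          refl (P s) q (q^ k) F (B k s) (B h s)) ⟩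
      P s * ν s + q^ (suc k) * (P s * ρ h k s) ∎
      where
      G = q^ ((suc h ∸ s) *ℕ (k ∸ s))
      F = q^ ((h ∸ s) *ℕ (k ∸ s))

    beyond-h : ∀ x → x * B h (suc h) ≈ 0#
    beyond-h x = trans (*-congˡ (B-vanish (n<1+n h))) (zeroʳ x)

    ν₋-sum : wsum P (suc h) ν₋ ≈ wsum P h ν + q^ (suc k) * Rhs h k
    ν₋-sum = begin
      wsum P (suc h) ν₋
        ≈⟨ sum-shift h _ ⟩
      P 0 * 0# + sumTo h (λ s → P (suc s) * ν s)
        ≈⟨ trans (+-congʳ (zeroʳ _)) (+-identityˡ _) ⟩
      sumTo h (λ s → P (suc s) * ν s)
        ≈⟨ sum-split h (λ s _ → weight-step s) ⟩
      wsum P h ν + sumTo h (λ s → q^ (suc k) * (P s * ρ h k s))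
        ≈⟨ +-congˡ (sum-scale h _ _) ⟩
      wsum P h ν + q^ (suc k) * Rhs h k ∎

    Rhs-split : Rhs (suc h) k ≈ wsum P h ν + wsum P (suc h) μ
    Rhs-split = trans (wsum-split P (suc h) (λ j _ → ρ-split' j))
                      (+-congʳ (wsum-dropLast P h ν (beyond-h _)))

    recurrence : Rhs (suc h) (suc k) ≈ Rhs (suc h) k + q^ (suc k) * (Rhs h (suc k) + Rhs h k)
    recurrence = begin
      Rhs (suc h) (suc k)
        ≈⟨ wsum-split P (suc h) (λ j _ → ρ-split j) ⟩
      wsum P (suc h) (λ j → q^ (suc k) * ρ h (suc k) j) + wsum P (suc h) τ
        ≈⟨ +-cong (trans (wsum-scale P (suc h) _ _) (*-congˡ (wsum-dropLast P h _ (beyond-h _))))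
                  (wsum-split P (suc h) (λ j _ → τ-split j)) ⟩
      q^ (suc k) * Rhs h (suc k) + (Σμ + wsum P (suc h) ν₋)
        ≈⟨ +-congˡ (+-congˡ ν₋-sum) ⟩
      q^ (suc k) * Rhs h (suc k) + (Σμ + (wsum P h ν + q^ (suc k) * Rhs h k))
        ≈⟨ solve 5 (λ c x m n y → c :* x :+ (m :+ (n :+ c :* y)) := (n :+ m) :+ c :* (x :+ y))
                 refl (q^ (suc k)) (Rhs h (suc k)) Σμ (wsum P h ν) (Rhs h k) ⟩
      (wsum P h ν + Σμ) + q^ (suc k) * (Rhs h (suc k) + Rhs h k)
        ≈⟨ +-congʳ (sym Rhs-split) ⟩
      Rhs (suc h) k + q^ (suc k) * (Rhs h (suc k) + Rhs h k) ∎
      where Σμ = wsum P (suc h) μ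

  record DelannoyFamily (F : ℕ → ℕ → Carrier) : Set ℓ where
    field
      left-edge   : ∀ k → F 0 k ≈ 1#
      bottom-edge : ∀ h → F h 0 ≈ 1#
      recurrence  : ∀ h k → F (suc h) (suc k) ≈ F (suc h) k + q^ (suc k) * (F h (suc k) + F h k)

  open DelannoyFamily

  unique : ∀ {F G} → DelannoyFamily F → DelannoyFamily G → ∀ h k → F h k ≈ G h k
  unique 𝔽 𝔾 zero    k       = trans (left-edge 𝔽 k) (sym (left-edge 𝔾 k))
  unique 𝔽 𝔾 (suc h) zero    = trans (bottom-edge 𝔽 (suc h)) (sym (bottom-edge 𝔾 (suc h)))
  unique 𝔽 𝔾 (suc h) (suc k) = begin
    _ ≈⟨ recurrence 𝔽 h k ⟩
    _ ≈⟨ +-cong (unique 𝔽 𝔾 (suc h) k) (*-congˡ (+-cong (unique 𝔽 𝔾 h (suc k)) (unique 𝔽 𝔾 h k))) ⟩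
    _ ≈⟨ sym (recurrence 𝔾 h k) ⟩
    _ ∎

  -- Both sides are such families.  On the edges only j = 0 contributes, since
  -- [0,j] = 0 for j > 0, and the remaining factors are 1 ([k,k] = 1, q^{h·0} = 1).
  D-family : DelannoyFamily D
  D-family = record
    { left-edge   = λ k → trans (*-congˡ (B-diag k)) (trans (*-identityʳ _) (*-identityʳ _))
    ; bottom-edge = λ h → trans (sum-head h (δ h 0) (λ j → trans (*-congʳ (zeroʳ _)) (zeroˡ _)))
                                (trans (*-identityʳ _) (*-identityʳ _))
    ; recurrence  = DRecurrence.recurrence
    }

  Rhs-family : DelannoyFamily Rhs
  Rhs-family = record
    { left-edge   = λ k → trans (*-identityˡ _) (trans (*-identityʳ _) (*-identityʳ _))
    ; bottom-edge = λ h → trans (sum-head h _ (λ j → trans (*-congˡ (trans (*-congʳ (zeroʳ _)) (zeroˡ _)))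
                                                          (zeroʳ _)))
                                (trans (*-identityˡ _)
                                (trans (*-identityʳ _) (trans (*-identityʳ _) (pow-cong q (*-zeroʳ h)))))
    ; recurrence  = RhsRecurrence.recurrence
    }

  Rhs-unfold : ∀ h k → Rhs h k ≈ sumTo h (λ j → q^ ((h ∸ j) *ℕ (k ∸ j)) * P j * B k j * B h j)
  Rhs-unfold h k = sum-cong h (λ j _ →
    solve 4 (λ p e a b → p :* (e :* a :* b) := e :* p :* a :* b) refl (P j) _ (B k j) (B h j))

mainTheorem3 : ∀ {c ℓ : Level} (R : CommutativeRing c ℓ) (q : CommutativeRing.Carrier R) (h k : ℕ) →
    let open CommutativeRing R
        open QDefs R
    in qDelannoy q h k ≈ sumTo h (λ j → pow q ((h ∸ j) *ℕ (k ∸ j)) * negQPoch q j * qBinom q k j * qBinom q h j)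
mainTheorem3 R q h k = trans (unique D-family Rhs-family h k) (Rhs-unfold h k)
  where
  open CommutativeRing R using (trans)
  open QDelannoyIdentity R q
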